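{- Let $m$ be a positive integer and let $0<c<1/2$. There exists a graph $G$ on the vertex set $2^{[m]}$ with maximum degree at most $2\lceil 1/c\rceil$ such that for every $x\in 2^{[m]}$ satisfying $cm\leq|x|\leq(1-c)m$, there exist $x_1,x_2\in 2^{[m]}$ with $x_1\subset x\subset x_2$ such that $xx_1$ and $xx_2$ are edges of $G$.
   Formalization: The parameter c is taken over the rationals, with 0 < c < 1/2. -}

module Defs where

open import Data.Bool using (Bool; true; false; if_then_else_)
open import Data.Nat using (ℕ; zero; suc)
open import Data.List using (List; []; _∷_; map; _++_)
open import Data.Nat.ListAction using (sum)
open import Data.Vec using (Vec; []; _∷_)
open import Data.Fin.Subset using (Subset)
open import Data.Integer using (ℤ)
open import Data.Rational using (ℚ; 0ℚ; _<_; ceiling; 1/_; positive)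
open import Data.Rational.Properties using (pos⇒nonZero)
open import Relation.Binary.PropositionalEquality using (_≡_)

allSubsets : (n : ℕ) → List (Subset n)
allSubsets zero    = [] ∷ []
allSubsets (suc n) = map (true ∷_) (allSubsets n) ++ map (false ∷_) (allSubsets n)

record Graph (n : ℕ) : Set where
  field
    adj    : Subset n → Subset n → Bool
    sym    : ∀ x y → adj x y ≡ adj y x
    irrefl : ∀ x → adj x x ≡ false

open Graph public

Edge : ∀ {n} → Graph n → Subset n → Subset n → Set
Edge G x y = adj G x y ≡ true

degree : ∀ {n} → Graph n → Subset n → ℕ
degree {n} G x = sum (map (λ y → if adj G x y then 1 else 0) (allSubsets n))

ceilInv : (c : ℚ) → 0ℚ < c → ℤ
ceilInv c 0<c = ceiling ((1/ c) {{pos⇒nonZero c {{positive 0<c}}}})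

module Submission where

-- Write ⌈1/c⌉ = K + 1 and read a subset x of [m] as a bit string.  Its walk climbs K at every
-- 0-bit and descends 1 at every 1-bit; the pivot of x is the last time in [0, m−1] at which the
-- walk is lowest, and the up-step of x switches on the bit at the pivot.  If (K+1)|x| ≤ K·m the
-- walk ends at height ≥ 0, which forces the pivot bit to be 0: the up-step exists and is a proper
-- superset.  An up-step lands in v only by switching on a "lowering" position of v; the walk
-- heights of v at lowering positions below m−1 strictly decrease inside a window (g, g+K], so
-- at most K+1 up-steps leave or enter v.  Down-steps are up-steps conjugated by complementation,
-- so joining every x to its up- and down-step gives degrees ≤ 2(K+1); and (K+1)c ≥ 1 turns
-- cm ≤ |x| ≤ (1−c)m into the two conditions under which both steps exist.

open import Defs hiding (sym)
open import Data.Nat using (ℕ; NonZero; suc)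
open import Data.Fin.Subset using (Subset; _⊂_; ∣_∣)
open import Data.Product using (Σ; _×_; _,_)

module Counting where
  open import Data.Bool using (Bool; true; false; _∧_; _∨_; if_then_else_)
  import Data.Bool.Properties as Bool
  open import Data.Nat using (zero; suc; _+_; _≤_; _<_; z≤n; s≤s)
  open import Data.Nat.Properties
    using (≤-trans; ≤-reflexive; n≤1+n; m≤n⇒m≤1+n; +-comm; +-assoc; +-suc; +-mono-≤; +-monoʳ-≤;
           m≤n⇒m<n∨m≡n)
  open import Data.Nat.ListAction using (sum)
  open import Data.List using (List; []; _∷_; map; _++_)
  open import Data.Vec using ([]; _∷_)
  open import Data.Vec.Properties using (≡-dec)
  open import Data.Fin.Subset using (∁)
  open import Data.Sum using (inj₁; inj₂)
  open import Data.Product using (_,_)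
  open import Relation.Nullary using (does; yes; no)
  open import Relation.Nullary.Decidable using (dec-true; does-⇔)
  open import Relation.Binary.PropositionalEquality
  open import Relation.Binary.Definitions using (DecidableEquality)
  open import Function.Bundles using (mk⇔)

  ind : Bool → ℕ
  ind b = if b then 1 else 0

  count : {A : Set} → (A → Bool) → List A → ℕ
  count f ys = sum (map (λ y → ind (f y)) ys)

  countBelow : (ℕ → Bool) → ℕ → ℕ
  countBelow sel zero    = 0
  countBelow sel (suc k) = countBelow sel k + ind (sel k)

  module _ {A : Set} where

    count-mono : (f g : A → Bool) (ys : List A) → (∀ y → f y ≡ true → g y ≡ true) → count f ys ≤ count g ys
    count-mono f g []       f⇒g = z≤n
    count-mono f g (y ∷ ys) f⇒g with f y in fy | g y in gy
    ... | true  | true  = s≤s (count-mono f g ys f⇒g)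
    ... | true  | false with () ← trans (sym (f⇒g y fy)) gy
    ... | false | true  = m≤n⇒m≤1+n (count-mono f g ys f⇒g)
    ... | false | false = count-mono f g ys f⇒g

    count-∨ : (f g : A → Bool) (ys : List A) → count (λ y → f y ∨ g y) ys ≤ count f ys + count g ys
    count-∨ f g []       = z≤n
    count-∨ f g (y ∷ ys) with f y | g y
    ... | true  | true  = s≤s (≤-trans (count-∨ f g ys) (+-monoʳ-≤ (count f ys) (n≤1+n _)))
    ... | true  | false = s≤s (count-∨ f g ys)
    ... | false | true  = subst (suc (count (λ y → f y ∨ g y) ys) ≤_) (sym (+-suc _ _)) (s≤s (count-∨ f g ys))
    ... | false | false = count-∨ f g ys

    count-none : (ys : List A) → count (λ _ → false) ys ≡ 0
    count-none []       = refl
    count-none (y ∷ ys) = count-none ys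

    count-++ : (f : A → Bool) (xs ys : List A) → count f (xs ++ ys) ≡ count f xs + count f ys
    count-++ f []       ys = refl
    count-++ f (x ∷ xs) ys = trans (cong (ind (f x) +_) (count-++ f xs ys)) (sym (+-assoc (ind (f x)) _ _))

  count-map : {A B : Set} (f : B → Bool) (h : A → B) (xs : List A) → count f (map h xs) ≡ count (λ x → f (h x)) xs
  count-map f h []       = refl
  count-map f h (x ∷ xs) = cong (ind (f (h x)) +_) (count-map f h xs)

  count-allSubsets-suc : ∀ {n} (f : Subset (suc n) → Bool) →
    count f (allSubsets (suc n)) ≡ count (λ y → f (true ∷ y)) (allSubsets n) + count (λ y → f (false ∷ y)) (allSubsets n)
  count-allSubsets-suc {n} f = trans (count-++ f (map (true ∷_) (allSubsets n)) _)
    (cong₂ _+_ (count-map f (true ∷_) (allSubsets n)) (count-map f (false ∷_) (allSubsets n)))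

  count-∁ : ∀ {n} (f : Subset n → Bool) → count (λ y → f (∁ y)) (allSubsets n) ≡ count f (allSubsets n)
  count-∁ {zero}  f = refl
  count-∁ {suc n} f = begin
    count (λ y → f (∁ y)) (allSubsets (suc n))
      ≡⟨ count-allSubsets-suc (λ y → f (∁ y)) ⟩
    count (λ y → f (false ∷ ∁ y)) A + count (λ y → f (true ∷ ∁ y)) A
      ≡⟨ cong₂ _+_ (count-∁ (λ y → f (false ∷ y))) (count-∁ (λ y → f (true ∷ y))) ⟩
    count (λ y → f (false ∷ y)) A + count (λ y → f (true ∷ y)) A
      ≡⟨ +-comm (count (λ y → f (false ∷ y)) A) _ ⟩
    count (λ y → f (true ∷ y)) A + count (λ y → f (false ∷ y)) A
      ≡⟨ sym (count-allSubsets-suc f) ⟩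
    count f (allSubsets (suc n)) ∎
    where open ≡-Reasoning
          A = allSubsets n

  _≟ₛ_ : ∀ {n} → DecidableEquality (Subset n)
  _≟ₛ_ = ≡-dec Bool._≟_

  _==ₛ_ : ∀ {n} → Subset n → Subset n → Bool
  x ==ₛ y = does (x ≟ₛ y)

  ==ₛ-refl : ∀ {n} (x : Subset n) → (x ==ₛ x) ≡ true
  ==ₛ-refl x = dec-true (x ≟ₛ x) refl

  ==ₛ-sym : ∀ {n} (x y : Subset n) → (x ==ₛ y) ≡ (y ==ₛ x)
  ==ₛ-sym x y = does-⇔ (mk⇔ sym sym) (x ≟ₛ y) (y ≟ₛ x)

  ==ₛ-sound : ∀ {n} {x y : Subset n} → (x ==ₛ y) ≡ true → x ≡ y
  ==ₛ-sound {x = x} {y} eq with x ≟ₛ y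
  ... | yes x≡y = x≡y
  ... | no  _   with () ← eq

  count-point : ∀ {n} (s : Subset n) → count (_==ₛ s) (allSubsets n) ≡ 1
  count-point []          = refl
  count-point {suc n} (true ∷ s) = begin
    count (_==ₛ (true ∷ s)) (allSubsets (suc n))   ≡⟨ count-allSubsets-suc (_==ₛ (true ∷ s)) ⟩
    count (_==ₛ s) A + count (λ _ → false) A       ≡⟨ cong₂ _+_ (count-point s) (count-none A) ⟩
    1 ∎
    where open ≡-Reasoning
          A = allSubsets n
  count-point {suc n} (false ∷ s) = begin
    count (_==ₛ (false ∷ s)) (allSubsets (suc n))  ≡⟨ count-allSubsets-suc (_==ₛ (false ∷ s)) ⟩
    count (λ _ → false) A + count (_==ₛ s) A       ≡⟨ cong₂ _+_ (count-none A) (count-point s) ⟩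
    1 ∎
    where open ≡-Reasoning
          A = allSubsets n

  count-guarded-point : ∀ {n} (b : Bool) (s : Subset n) → count (λ y → b ∧ (y ==ₛ s)) (allSubsets n) ≡ ind b
  count-guarded-point         true  s = count-point s
  count-guarded-point {n} false s = count-none (allSubsets n)

  count-covered : ∀ {n} (f : Subset n → Bool) (sel : ℕ → Bool) (h : ℕ → Subset n) (k : ℕ) →
    (∀ y → f y ≡ true → Σ ℕ λ j → j < k × sel j ≡ true × y ≡ h j) →
    count f (allSubsets n) ≤ countBelow sel k
  count-covered {n} f sel h k covered =
    ≤-trans (count-mono f (hits k) A (λ y fy → hits-covered y (covered y fy))) (count-hits k)
    where
    A = allSubsets n
    hits : ℕ → Subset n → Bool
    hits zero    y = false
    hits (suc k) y = hits k y ∨ (sel k ∧ (y ==ₛ h k))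

    hits-covered : ∀ {k} y → (Σ ℕ λ j → j < k × sel j ≡ true × y ≡ h j) → hits k y ≡ true
    hits-covered {suc k} y (j , j<1+k , sel-j , refl) with m≤n⇒m<n∨m≡n j<1+k
    ... | inj₁ (s≤s j<k) rewrite hits-covered (h j) (j , j<k , sel-j , refl) = refl
    ... | inj₂ refl      rewrite sel-j | ==ₛ-refl (h k) = Bool.∨-zeroʳ (hits k (h k))

    count-hits : ∀ k → count (hits k) A ≤ countBelow sel k
    count-hits zero    = ≤-reflexive (count-none A)
    count-hits (suc k) = ≤-trans (count-∨ (hits k) _ A)
      (+-mono-≤ (count-hits k) (≤-reflexive (count-guarded-point (sel k) (h k))))

module BitStrings where
  open import Data.Bool using (Bool; true; false)
  open import Data.Bool.Properties using (not-involutive)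
  open import Data.Nat using (zero; suc; _<_; s≤s)
  open import Data.Nat.Properties using (<-irrefl)
  open import Data.Fin using (Fin; toℕ; fromℕ<)
  import Data.Fin as Fin
  open import Data.Fin.Properties using (toℕ-fromℕ<)
  open import Data.Fin.Subset using (_∈_; ∁)
  open import Data.Fin.Subset.Properties using (p⊂q⇒∣p∣<∣q∣)
  open import Data.Vec using (Vec; []; _∷_; lookup)
  open import Data.Vec.Properties using ([]=⇒lookup; lookup⇒[]=)
  open import Data.Product using (_,_)
  open import Data.Empty using (⊥-elim)
  open import Relation.Nullary using (¬_)
  open import Relation.Binary.PropositionalEquality

  -- The j-th bit (false beyond the end).
  bit : ∀ {n} → Vec Bool n → ℕ → Bool
  bit []       _       = false
  bit (b ∷ x) zero    = b
  bit (b ∷ x) (suc j) = bit x j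

  -- Overwrite the j-th bit (no effect beyond the end).
  setAt : ∀ {n} → Vec Bool n → ℕ → Bool → Vec Bool n
  setAt []       _       c = []
  setAt (b ∷ x) zero    c = c ∷ x
  setAt (b ∷ x) (suc j) c = b ∷ setAt x j c

  bit-setAt-same : ∀ {n} (x : Vec Bool n) j c → j < n → bit (setAt x j c) j ≡ c
  bit-setAt-same (b ∷ x) zero    c _         = refl
  bit-setAt-same (b ∷ x) (suc j) c (s≤s j<n) = bit-setAt-same x j c j<n

  bit-setAt-other : ∀ {n} (x : Vec Bool n) j c k → k ≢ j → bit (setAt x j c) k ≡ bit x k
  bit-setAt-other []      j       c k       k≢j = refl
  bit-setAt-other (b ∷ x) zero    c zero    k≢j = ⊥-elim (k≢j refl)
  bit-setAt-other (b ∷ x) zero    c (suc k) k≢j = refl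
  bit-setAt-other (b ∷ x) (suc j) c zero    k≢j = refl
  bit-setAt-other (b ∷ x) (suc j) c (suc k) k≢j = bit-setAt-other x j c k (λ k≡j → k≢j (cong suc k≡j))

  setAt-setAt : ∀ {n} (x : Vec Bool n) j c d → setAt (setAt x j c) j d ≡ setAt x j d
  setAt-setAt []      j       c d = refl
  setAt-setAt (b ∷ x) zero    c d = refl
  setAt-setAt (b ∷ x) (suc j) c d = cong (b ∷_) (setAt-setAt x j c d)

  setAt-bit : ∀ {n} (x : Vec Bool n) j → setAt x j (bit x j) ≡ x
  setAt-bit []      j       = refl
  setAt-bit (b ∷ x) zero    = refl
  setAt-bit (b ∷ x) (suc j) = cong (b ∷_) (setAt-bit x j)

  ∁-involutive : ∀ {n} (x : Subset n) → ∁ (∁ x) ≡ x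
  ∁-involutive []      = refl
  ∁-involutive (b ∷ x) = cong₂ _∷_ (not-involutive b) (∁-involutive x)

  bit-toℕ : ∀ {n} (x : Subset n) (i : Fin n) → bit x (toℕ i) ≡ lookup x i
  bit-toℕ (b ∷ x) Fin.zero    = refl
  bit-toℕ (b ∷ x) (Fin.suc i) = bit-toℕ x i

  ∈⇒bit : ∀ {n} {x : Subset n} {i : Fin n} → i ∈ x → bit x (toℕ i) ≡ true
  ∈⇒bit {x = x} {i} i∈x = trans (bit-toℕ x i) ([]=⇒lookup i∈x)

  bit⇒∈ : ∀ {n} {x : Subset n} {i : Fin n} → bit x (toℕ i) ≡ true → i ∈ x
  bit⇒∈ {x = x} {i} eq = lookup⇒[]= i x (trans (sym (bit-toℕ x i)) eq)

  ⊂-setAt : ∀ {n} (x : Subset n) j → j < n → bit x j ≡ false → x ⊂ setAt x j true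
  ⊂-setAt x j j<n off = kept , i , bit⇒∈ added , absent
    where
    i = fromℕ< j<n
    toℕ-i : toℕ i ≡ j
    toℕ-i = toℕ-fromℕ< j<n
    true≢false : ¬ (true ≡ false)
    true≢false ()
    added : bit (setAt x j true) (toℕ i) ≡ true
    added rewrite toℕ-i = bit-setAt-same x j true j<n
    absent : ¬ (i ∈ x)
    absent i∈x = true≢false (trans (sym (∈⇒bit i∈x)) (trans (cong (bit x) toℕ-i) off))
    kept : ∀ {k} → k ∈ x → k ∈ setAt x j true
    kept {k} k∈x = bit⇒∈ (trans (bit-setAt-other x j true (toℕ k) k≢j) (∈⇒bit k∈x))
      where k≢j : toℕ k ≢ j
            k≢j k≡j = true≢false (trans (sym (∈⇒bit k∈x)) (trans (cong (bit x) k≡j) off))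

  ⊂⇒≢ : ∀ {n} {x y : Subset n} → x ⊂ y → x ≢ y
  ⊂⇒≢ x⊂y refl = <-irrefl refl (p⊂q⇒∣p∣<∣q∣ x⊂y)

module LastArgmin where
  open import Data.Bool using (if_then_else_)
  open import Data.Nat using (zero; suc; _≤_; _<_; _≤?_; z≤n; s≤s)
  open import Data.Nat.Properties using (≤-refl; <-irrefl; <-≤-trans; <⇒≤; m≤n⇒m≤1+n; ≰⇒>; m≤n⇒m<n∨m≡n)
  open import Data.Integer as ℤ using (ℤ)
  import Data.Integer.Properties as ℤₚ
  open import Data.Sum using (inj₁; inj₂)
  open import Data.Empty using (⊥-elim)
  open import Relation.Nullary using (does; yes; no; contradiction)
  open import Relation.Binary.PropositionalEquality

  lastArgmin : (ℕ → ℤ) → ℕ → ℕ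
  lastArgmin f zero    = zero
  lastArgmin f (suc M) =
    if does (f (suc M) ℤ.≤? f (lastArgmin f M)) then suc M else lastArgmin f M

  record IsLastArgmin (f : ℕ → ℤ) (M a : ℕ) : Set where
    field
      bounded : a ≤ M
      minimal : ∀ t → t ≤ M → f a ℤ.≤ f t
      last    : ∀ t → a < t → t ≤ M → f a ℤ.< f t

  lastArgmin-spec : ∀ f M → IsLastArgmin f M (lastArgmin f M)
  lastArgmin-spec f zero = record
    { bounded = z≤n
    ; minimal = λ { zero z≤n → ℤₚ.≤-refl }
    ; last    = λ { t 0<t z≤n → ⊥-elim (<-irrefl refl 0<t) }
    }
  lastArgmin-spec f (suc M) with f (suc M) ℤ.≤? f (lastArgmin f M) | lastArgmin-spec f M
  ... | yes new≤old | old = record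
    { bounded = ≤-refl
    ; minimal = minimal′
    ; last    = λ t M+1<t t≤M+1 → contradiction (<-≤-trans M+1<t t≤M+1) (<-irrefl refl)
    }
    where
    open IsLastArgmin old
    minimal′ : ∀ t → t ≤ suc M → f (suc M) ℤ.≤ f t
    minimal′ t t≤M+1 with m≤n⇒m<n∨m≡n t≤M+1
    ... | inj₁ (s≤s t≤M) = ℤₚ.≤-trans new≤old (minimal t t≤M)
    ... | inj₂ refl      = ℤₚ.≤-refl
  ... | no new≰old | old = record
    { bounded = m≤n⇒m≤1+n bounded
    ; minimal = minimal′
    ; last    = last′
    }
    where
    open IsLastArgmin old
    old<new : f (lastArgmin f M) ℤ.< f (suc M)
    old<new = ℤₚ.≰⇒> new≰old
    minimal′ : ∀ t → t ≤ suc M → f (lastArgmin f M) ℤ.≤ f t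
    minimal′ t t≤M+1 with m≤n⇒m<n∨m≡n t≤M+1
    ... | inj₁ (s≤s t≤M) = minimal t t≤M
    ... | inj₂ refl      = ℤₚ.<⇒≤ old<new
    last′ : ∀ t → lastArgmin f M < t → t ≤ suc M → f (lastArgmin f M) ℤ.< f t
    last′ t a<t t≤M+1 with m≤n⇒m<n∨m≡n t≤M+1
    ... | inj₁ (s≤s t≤M) = last t a<t t≤M
    ... | inj₂ refl      = old<new

  prefix-minimum⇒≤ : ∀ {f M a} → IsLastArgmin f M a → ∀ j → j ≤ M → (∀ t → t ≤ j → f j ℤ.≤ f t) → j ≤ a
  prefix-minimum⇒≤ {f} {M} {a} spec j j≤M j-min with j ≤? a
  ... | yes j≤a = j≤a
  ... | no  j≰a = contradiction (j-min a (<⇒≤ a<j)) (ℤₚ.<⇒≱ (IsLastArgmin.last spec j a<j j≤M))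
    where a<j = ≰⇒> j≰a

module DecreasingSelection where
  open import Data.Bool using (Bool; true; false)
  open import Data.Nat using (zero; suc; _+_; _≤_; _<_; z≤n)
  open import Data.Nat.Properties using (≤-refl; <⇒≤; +-identityʳ; +-comm)
  open import Data.Integer as ℤ using (ℤ; +_; 1ℤ; -_)
  import Data.Integer.Properties as ℤₚ
  open import Data.Integer.Tactic.RingSolver using (solve-∀)
  open import Data.Product using (_,_; proj₁; proj₂)
  open import Relation.Binary.PropositionalEquality
  open Counting using (countBelow)

  headroom : ∀ c K {lo v : ℤ} → lo ℤ.< v → + c ℤ.+ v ℤ.≤ lo ℤ.+ + K → suc c ≤ K
  headroom c K {lo} {v} lo<v bound = ℤₚ.drop‿+≤+ (begin
    + suc c                        ≡⟨ shift-out (+ c) lo ⟩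
    (+ c ℤ.+ ℤ.suc lo) ℤ.- lo      ≤⟨ ℤₚ.+-monoˡ-≤ (- lo) (ℤₚ.+-monoʳ-≤ (+ c) (ℤₚ.i<j⇒suc[i]≤j lo<v)) ⟩
    (+ c ℤ.+ v) ℤ.- lo             ≤⟨ ℤₚ.+-monoˡ-≤ (- lo) bound ⟩
    (lo ℤ.+ + K) ℤ.- lo            ≡⟨ cancel lo (+ K) ⟩
    + K                            ∎)
    where
    open ℤₚ.≤-Reasoning
    shift-out : ∀ c l → 1ℤ ℤ.+ c ≡ (c ℤ.+ (1ℤ ℤ.+ l)) ℤ.- l
    shift-out = solve-∀
    cancel : ∀ l k → (l ℤ.+ k) ℤ.- l ≡ k
    cancel = solve-∀

  room-below : ∀ c {v w b : ℤ} → w ℤ.< v → + c ℤ.+ v ℤ.≤ b → + suc c ℤ.+ w ℤ.≤ b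
  room-below c {v} {w} {b} w<v bound = begin
    + suc c ℤ.+ w          ≡⟨ regroup (+ c) w ⟩
    + c ℤ.+ ℤ.suc w        ≤⟨ ℤₚ.+-monoʳ-≤ (+ c) (ℤₚ.i<j⇒suc[i]≤j w<v) ⟩
    + c ℤ.+ v              ≤⟨ bound ⟩
    b                      ∎
    where
    open ℤₚ.≤-Reasoning
    regroup : ∀ c w → (1ℤ ℤ.+ c) ℤ.+ w ≡ c ℤ.+ (1ℤ ℤ.+ w)
    regroup = solve-∀

  decreasing-selection-bound : (sel : ℕ → Bool) (val : ℕ → ℤ) (lo : ℤ) (K n : ℕ) →
    (∀ j → j < n → sel j ≡ true → lo ℤ.< val j × val j ℤ.≤ lo ℤ.+ + K) →
    (∀ i j → i < j → j < n → sel i ≡ true → sel j ≡ true → val j ℤ.< val i) →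
    countBelow sel n ≤ K
  decreasing-selection-bound sel val lo K n inside decreasing = proj₁ (budget n ≤-refl)
    where
    Budget : ℕ → Set
    Budget k = countBelow sel k ≤ K ×
               (∀ j → k ≤ j → j < n → sel j ≡ true → + countBelow sel k ℤ.+ val j ℤ.≤ lo ℤ.+ + K)

    budget : ∀ k → k ≤ n → Budget k
    budget zero    _   = z≤n , λ j _ j<n sel-j →
      subst (ℤ._≤ lo ℤ.+ + K) (sym (ℤₚ.+-identityˡ (val j))) (proj₂ (inside j j<n sel-j))
    budget (suc k) k<n with budget k (<⇒≤ k<n) | sel k in sel-k
    ... | count≤K , later | false rewrite +-identityʳ (countBelow sel k) =
          count≤K , λ j k<j j<n sel-j → later j (<⇒≤ k<j) j<n sel-j
    ... | count≤K , later | true rewrite +-comm (countBelow sel k) 1 =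
          headroom _ K (proj₁ (inside k k<n sel-k)) (later k ≤-refl k<n sel-k) ,
          λ j k<j j<n sel-j → room-below _ (decreasing k j k<j j<n sel-k sel-j) (later k ≤-refl k<n sel-k)

module Walk (K : ℕ) where
  open import Data.Bool using (Bool; true; false)
  open import Data.Nat using (zero; suc; _*_; _≤_; _<_; s≤s)
  open import Data.Integer as ℤ using (ℤ; +_; 0ℤ; -1ℤ; 1ℤ)
  import Data.Integer.Properties as ℤₚ
  open import Data.Integer.Tactic.RingSolver using (solve-∀)
  open import Data.Vec using ([]; _∷_)
  open import Relation.Binary.PropositionalEquality
  open BitStrings using (bit; setAt)

  step : Bool → ℤ
  step true  = -1ℤ
  step false = + K

  exchange : ∀ a b w → a ℤ.+ (b ℤ.+ w) ≡ b ℤ.+ (a ℤ.+ w)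
  exchange = solve-∀

  walk : ∀ {n} → Subset n → ℕ → ℤ
  walk x       zero    = 0ℤ
  walk []      (suc t) = 0ℤ
  walk (b ∷ x) (suc t) = step b ℤ.+ walk x t

  walk-suc : ∀ {n} (x : Subset n) t → t < n → walk x (suc t) ≡ step (bit x t) ℤ.+ walk x t
  walk-suc (b ∷ x) zero    _         = refl
  walk-suc (b ∷ x) (suc t) (s≤s t<n) = begin
    step b ℤ.+ walk x (suc t)                    ≡⟨ cong (λ w → step b ℤ.+ w) (walk-suc x t t<n) ⟩
    step b ℤ.+ (step (bit x t) ℤ.+ walk x t)    ≡⟨ exchange (step b) (step (bit x t)) (walk x t) ⟩
    step (bit x t) ℤ.+ (step b ℤ.+ walk x t)    ∎
    where open ≡-Reasoning

  walk-setAt-≤ : ∀ {n} (x : Subset n) j c t → t ≤ j → walk (setAt x j c) t ≡ walk x t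
  walk-setAt-≤ x       j       c zero    _         = refl
  walk-setAt-≤ []      j       c (suc t) _         = refl
  walk-setAt-≤ (b ∷ x) (suc j) c (suc t) (s≤s t≤j) = cong (λ w → step b ℤ.+ w) (walk-setAt-≤ x j c t t≤j)

  walk-setAt-> : ∀ {n} (x : Subset n) j c t → j < t → j < n →
    step (bit x j) ℤ.+ walk (setAt x j c) t ≡ step c ℤ.+ walk x t
  walk-setAt-> (b ∷ x) zero    c (suc t) _         _         = exchange (step b) (step c) (walk x t)
  walk-setAt-> (b ∷ x) (suc j) c (suc t) (s≤s j<t) (s≤s j<n) = begin
    step (bit x j) ℤ.+ (step b ℤ.+ walk (setAt x j c) t)  ≡⟨ exchange (step (bit x j)) (step b) _ ⟩
    step b ℤ.+ (step (bit x j) ℤ.+ walk (setAt x j c) t)  ≡⟨ cong (λ w → step b ℤ.+ w) (walk-setAt-> x j c t j<t j<n) ⟩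
    step b ℤ.+ (step c ℤ.+ walk x t)                      ≡⟨ exchange (step b) (step c) (walk x t) ⟩
    step c ℤ.+ (step b ℤ.+ walk x t)                      ∎
    where open ≡-Reasoning

  walk-end : ∀ {n} (x : Subset n) → walk x n ≡ + K ℤ.* + n ℤ.- + suc K ℤ.* + ∣ x ∣
  walk-end []          = empty (+ K)
    where empty : ∀ k → 0ℤ ≡ k ℤ.* 0ℤ ℤ.- (1ℤ ℤ.+ k) ℤ.* 0ℤ
          empty = solve-∀
  walk-end {suc n} (true ∷ x) = begin
    -1ℤ ℤ.+ walk x n                                         ≡⟨ cong (λ w → -1ℤ ℤ.+ w) (walk-end x) ⟩
    -1ℤ ℤ.+ (+ K ℤ.* + n ℤ.- + suc K ℤ.* + ∣ x ∣)          ≡⟨ one-bit (+ K) (+ n) (+ ∣ x ∣) ⟩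
    + K ℤ.* + suc n ℤ.- + suc K ℤ.* + suc ∣ x ∣            ∎
    where open ≡-Reasoning
          one-bit : ∀ k n c → -1ℤ ℤ.+ (k ℤ.* n ℤ.- (1ℤ ℤ.+ k) ℤ.* c)
                          ≡ k ℤ.* (1ℤ ℤ.+ n) ℤ.- (1ℤ ℤ.+ k) ℤ.* (1ℤ ℤ.+ c)
          one-bit = solve-∀
  walk-end {suc n} (false ∷ x) = begin
    + K ℤ.+ walk x n                                         ≡⟨ cong (λ w → + K ℤ.+ w) (walk-end x) ⟩
    + K ℤ.+ (+ K ℤ.* + n ℤ.- + suc K ℤ.* + ∣ x ∣)          ≡⟨ zero-bit (+ K) (+ n) (+ ∣ x ∣) ⟩
    + K ℤ.* + suc n ℤ.- + suc K ℤ.* + ∣ x ∣                ∎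
    where open ≡-Reasoning
          zero-bit : ∀ k n c → k ℤ.+ (k ℤ.* n ℤ.- (1ℤ ℤ.+ k) ℤ.* c)
                               ≡ k ℤ.* (1ℤ ℤ.+ n) ℤ.- (1ℤ ℤ.+ k) ℤ.* c
          zero-bit = solve-∀

  walk-end-nonneg : ∀ {n} (x : Subset n) → suc K * ∣ x ∣ ≤ K * n → 0ℤ ℤ.≤ walk x n
  walk-end-nonneg {n} x small = subst (0ℤ ℤ.≤_) (sym (walk-end x))
    (ℤₚ.i≤j⇒0≤j-i (subst₂ ℤ._≤_ (ℤₚ.pos-* (suc K) ∣ x ∣) (ℤₚ.pos-* K n) (ℤ.+≤+ small)))

module UpStep (K M : ℕ) where
  open import Data.Bool using (Bool; true; false; not; _∧_)
  open import Data.Nat using (zero; suc; _+_; _≤_; _<_; _≟_; z≤n; s≤s)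
  open import Data.Nat.Properties
    using (≤-refl; ≤-reflexive; ≤-trans; <-trans; <⇒≤; ≤-antisym; ≤∧≢⇒<; m≤n⇒m<n∨m≡n; +-comm; +-identityʳ; +-mono-≤)
  open import Data.Integer as ℤ using (ℤ; +_; 0ℤ)
  import Data.Integer.Properties as ℤₚ
  open import Data.Product using (_,_; proj₁; proj₂)
  open import Data.Sum using (inj₁; inj₂)
  open import Relation.Nullary using (Dec; does; yes; no; contradiction)
  open import Relation.Nullary.Decidable using (dec-true)
  open import Relation.Binary.PropositionalEquality
  open Counting using (ind; count; countBelow; count-guarded-point; count-covered; _==ₛ_; ==ₛ-sound)
  open BitStrings
  open LastArgmin
  open DecreasingSelection using (decreasing-selection-bound)
  open Walk K

  pivot : Subset (suc M) → ℕ
  pivot x = lastArgmin (walk x) M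

  pivot-spec : ∀ x → IsLastArgmin (walk x) M (pivot x)
  pivot-spec x = lastArgmin-spec (walk x) M

  pivot<m : ∀ x → pivot x < suc M
  pivot<m x = s≤s (IsLastArgmin.bounded (pivot-spec x))

  canUp : Subset (suc M) → Bool
  canUp x = not (bit x (pivot x))

  up : Subset (suc M) → Subset (suc M)
  up x = setAt x (pivot x) true

  Up : Subset (suc M) → Subset (suc M) → Bool
  Up x y = canUp x ∧ (y ==ₛ up x)

  descend : ∀ {n} (x : Subset n) t → t < n → bit x t ≡ true → walk x (suc t) ≡ ℤ.pred (walk x t)
  descend x t t<n on = trans (walk-suc x t t<n) (cong (λ b → step b ℤ.+ walk x t) on)

  -- If the walk ends at a non-negative height, it does not go lower right after the pivot:
  -- inside [0, M] by minimality, and at time M+1 because it started at height 0.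
  rises-after-pivot : ∀ x → 0ℤ ℤ.≤ walk x (suc M) → walk x (pivot x) ℤ.≤ walk x (suc (pivot x))
  rises-after-pivot x nonneg with m≤n⇒m<n∨m≡n (IsLastArgmin.bounded (pivot-spec x))
  ... | inj₁ p<M = IsLastArgmin.minimal (pivot-spec x) (suc (pivot x)) p<M
  ... | inj₂ p≡M = ℤₚ.≤-trans (IsLastArgmin.minimal (pivot-spec x) zero z≤n)
                               (subst (λ t → 0ℤ ℤ.≤ walk x (suc t)) (sym p≡M) nonneg)

  -- Hence the bit at the pivot is off, since a 1-bit would lower the walk.
  pivot-off : ∀ x → 0ℤ ℤ.≤ walk x (suc M) → bit x (pivot x) ≡ false
  pivot-off x nonneg with bit x (pivot x) in on
  ... | false = refl
  ... | true  = contradiction (rises-after-pivot x nonneg) (ℤₚ.<⇒≱ lower)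
    where lower : walk x (suc (pivot x)) ℤ.< walk x (pivot x)
          lower = subst (ℤ._< walk x (pivot x)) (sym (descend x (pivot x) (pivot<m x) on))
                        (ℤₚ.i≤pred[j]⇒i<j ℤₚ.≤-refl)

  -- Position j of v is lowering if j ∈ v and removing j leaves a set whose pivot is j: these
  -- are exactly the positions through which an up-step can land in v.
  lowering : Subset (suc M) → ℕ → Bool
  lowering v j = bit v j ∧ does (pivot (setAt v j false) ≟ j)

  lowering-intro : ∀ v j → bit v j ≡ true → pivot (setAt v j false) ≡ j → lowering v j ≡ true
  lowering-intro v j on pivot≡j rewrite on = dec-true (pivot (setAt v j false) ≟ j) pivot≡j

  lowering-elim : ∀ v j → lowering v j ≡ true → bit v j ≡ true × pivot (setAt v j false) ≡ j
  lowering-elim v j = ∧-does (bit v j) (pivot (setAt v j false) ≟ j)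
    where ∧-does : ∀ {P : Set} b (d : Dec P) → b ∧ does d ≡ true → b ≡ true × P
          ∧-does true (yes p) _ = refl , p

  Up-source : ∀ y v → Up y v ≡ true → Σ ℕ λ j → j < suc M × lowering v j ≡ true × y ≡ setAt v j false
  Up-source y v up≡ with bit y (pivot y) in off
  ... | false = q , pivot<m y , lowering-intro v q on (cong pivot (sym y≡)) , y≡
    where
    q = pivot y
    v≡ : v ≡ setAt y q true
    v≡ = ==ₛ-sound up≡
    on : bit v q ≡ true
    on = trans (cong (λ z → bit z q) v≡) (bit-setAt-same y q true (pivot<m y))
    y≡ : y ≡ setAt v q false
    y≡ = begin
      y                             ≡⟨ sym (setAt-bit y q) ⟩
      setAt y q (bit y q)           ≡⟨ cong (setAt y q) off ⟩
      setAt y q false               ≡⟨ sym (setAt-setAt y q true false) ⟩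
      setAt (setAt y q true) q false ≡⟨ cong (λ z → setAt z q false) (sym v≡) ⟩
      setAt v q false               ∎
      where open ≡-Reasoning

  -- The load of v — whether v has an up-step, plus its number of lowering positions — is at
  -- most K + 1.  Let g be the lowest height of the walk of v on [0, M].  A lowering position
  -- j < M has walk height in (g, g + K], and these heights strictly decrease with j, so there
  -- are at most K of them; a lowering position M forces the pivot to be M and v to have no up-step.
  module Load (v : Subset (suc M)) where
    open IsLastArgmin (pivot-spec v) using (bounded; minimal)

    floor : ℤ
    floor = walk v (pivot v)

    module Lowering {j} (lowering-j : lowering v j ≡ true) where
      on : bit v j ≡ true
      on = proj₁ (lowering-elim v j lowering-j)

      spec : IsLastArgmin (walk (setAt v j false)) M j
      spec = subst (IsLastArgmin (walk (setAt v j false)) M) (proj₂ (lowering-elim v j lowering-j))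
                   (pivot-spec (setAt v j false))
      open IsLastArgmin spec using () renaming (bounded to j≤M; minimal to minimal-j; last to last-j)

      -- Up to time j the walks of v and v − j agree, so j is a lowest point of v's walk on [0, j].
      prefix-minimum : ∀ t → t ≤ j → walk v j ℤ.≤ walk v t
      prefix-minimum t t≤j = subst₂ ℤ._≤_ (walk-setAt-≤ v j false j ≤-refl) (walk-setAt-≤ v j false t t≤j)
                                     (minimal-j t (≤-trans t≤j j≤M))

      -- After time j the walk of v − j runs K + 1 higher than that of v, and strictly above its
      -- height at j; so the walk of v stays above height(j) − K.
      later-bound : ∀ t → j < t → t ≤ M → walk v j ℤ.≤ + K ℤ.+ walk v t
      later-bound t j<t t≤M = begin
        walk v j                                    ≡⟨ sym (walk-setAt-≤ v j false j ≤-refl) ⟩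
        walk (setAt v j false) j                    ≤⟨ ℤₚ.i<j⇒i≤pred[j] (last-j t j<t t≤M) ⟩
        ℤ.pred (walk (setAt v j false) t)           ≡⟨ cong (λ b → step b ℤ.+ walk (setAt v j false) t) (sym on) ⟩
        step (bit v j) ℤ.+ walk (setAt v j false) t ≡⟨ walk-setAt-> v j false t j<t (s≤s j≤M) ⟩
        + K ℤ.+ walk v t                            ∎
        where open ℤₚ.≤-Reasoning

      module _ (j<M : j < M) where
        -- the 1-bit at j lowers the walk, and it cannot go below the floor
        above-floor : floor ℤ.< walk v j
        above-floor = ℤₚ.i≤pred[j]⇒i<j (subst (floor ℤ.≤_) (descend v j (s≤s j≤M) on) (minimal (suc j) j<M))

        before-pivot : j < pivot v
        before-pivot = ≤∧≢⇒< (prefix-minimum⇒≤ (pivot-spec v) j j≤M prefix-minimum)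
                              (λ j≡p → ℤₚ.<-irrefl (cong (walk v) (sym j≡p)) above-floor)

        below-ceiling : walk v j ℤ.≤ floor ℤ.+ + K
        below-ceiling = subst (walk v j ℤ.≤_) (ℤₚ.+-comm (+ K) floor)
                              (later-bound (pivot v) before-pivot bounded)

    decreasing : ∀ i j → i < j → j < M → lowering v i ≡ true → lowering v j ≡ true → walk v j ℤ.< walk v i
    decreasing i j i<j j<M li lj = ℤₚ.≤-<-trans (Lowering.prefix-minimum lj (suc i) i<j)
      (subst (ℤ._< walk v i) (sym (descend v i (s≤s (<⇒≤ (<-trans i<j j<M))) (Lowering.on li)))
             (ℤₚ.i≤pred[j]⇒i<j ℤₚ.≤-refl))

    lowering-before-M : countBelow (lowering v) M ≤ K
    lowering-before-M = decreasing-selection-bound (lowering v) (walk v) floor K M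
      (λ j j<M lj → Lowering.above-floor lj j<M , Lowering.below-ceiling lj j<M) decreasing

    -- If M is lowering, it is the last lowest point of v's walk, hence the pivot, and is a 1-bit.
    lowering-at-M : lowering v M ≡ true → canUp v ≡ false
    lowering-at-M lM = cong not (trans (cong (bit v) pivot≡M) (Lowering.on lM))
      where pivot≡M : pivot v ≡ M
            pivot≡M = ≤-antisym bounded (prefix-minimum⇒≤ (pivot-spec v) M ≤-refl (Lowering.prefix-minimum lM))

    load-bound : ind (canUp v) + countBelow (lowering v) (suc M) ≤ suc K
    load-bound with lowering v M in lM
    ... | true rewrite lowering-at-M lM | +-comm (countBelow (lowering v) M) 1 = s≤s lowering-before-M
    ... | false rewrite +-identityʳ (countBelow (lowering v) M) = +-mono-≤ (ind≤1 (canUp v)) lowering-before-M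
      where ind≤1 : ∀ b → ind b ≤ 1
            ind≤1 true  = ≤-refl
            ind≤1 false = z≤n

  up-load : ∀ v → count (Up v) (allSubsets (suc M)) + count (λ y → Up y v) (allSubsets (suc M)) ≤ suc K
  up-load v = ≤-trans
    (+-mono-≤ (≤-reflexive (count-guarded-point (canUp v) (up v)))
              (count-covered (λ y → Up y v) (lowering v) (λ j → setAt v j false) (suc M) (λ y → Up-source y v)))
    (Load.load-bound v)

module GeneratedGraph where
  open import Data.Bool using (Bool; true; false; not; _∧_; _∨_)
  open import Data.Bool.Properties using (∨-comm)
  open import Data.Nat using (_+_; _≤_)
  open import Data.Nat.Properties using (≤-trans)
  open import Relation.Nullary.Decidable using (dec-false)
  open import Relation.Binary.PropositionalEquality
  open Counting

  generated : ∀ {n} → (Subset n → Subset n → Bool) → Graph n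
  generated R = record
    { adj    = λ x y → not (x ==ₛ y) ∧ (R x y ∨ R y x)
    ; sym    = λ x y → cong₂ (λ e r → not e ∧ r) (==ₛ-sym x y) (∨-comm (R x y) (R y x))
    ; irrefl = λ x → cong (λ e → not e ∧ (R x x ∨ R x x)) (==ₛ-refl x)
    }

  degree-generated : ∀ {n} (R : Subset n → Subset n → Bool) v →
    degree (generated R) v ≤ count (R v) (allSubsets n) + count (λ y → R y v) (allSubsets n)
  degree-generated {n} R v = ≤-trans (count-mono _ _ (allSubsets n) second) (count-∨ (R v) (λ y → R y v) (allSubsets n))
    where second : ∀ y → not (v ==ₛ y) ∧ (R v y ∨ R y v) ≡ true → R v y ∨ R y v ≡ true
          second y e with v ==ₛ y
          ... | false = e

  generated-edge : ∀ {n} (R : Subset n → Subset n → Bool) {x y} → x ≢ y → R x y ≡ true → Edge (generated R) x y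
  generated-edge R {x} {y} x≢y Rxy rewrite dec-false (x ≟ₛ y) x≢y | Rxy = refl

module Construction (K M : ℕ) where
  open import Data.Bool using (Bool; true; false; _∨_)
  open import Data.Bool.Properties using (∨-zeroʳ)
  open import Data.Nat using (suc; _+_; _*_; _∸_; _≤_)
  open import Data.Nat.Properties using (+-identityʳ; +-mono-≤; +-commutativeSemigroup; module ≤-Reasoning)
  open import Algebra.Properties.CommutativeSemigroup +-commutativeSemigroup using (interchange)
  open import Data.Fin.Subset using (∁)
  open import Data.Fin.Subset.Properties using (∁p⊂∁q⇒p⊃q; ∣∁p∣≡n∸∣p∣)
  open import Data.Product using (_,_)
  open import Relation.Binary.PropositionalEquality
  open Counting using (count; count-∨; count-∁; ==ₛ-refl)
  open BitStrings using (bit; ⊂-setAt; ⊂⇒≢; ∁-involutive)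
  open GeneratedGraph
  open UpStep K M
  open Walk K using (walk-end-nonneg)

  Step : Subset (suc M) → Subset (suc M) → Bool
  Step x y = Up x y ∨ Up (∁ x) (∁ y)

  G : Graph (suc M)
  G = generated Step

  down : Subset (suc M) → Subset (suc M)
  down x = ∁ (up (∁ x))

  -- Every vertex carries the load of itself and of its complement.
  degree-bound : ∀ v → degree G v ≤ 2 * suc K
  degree-bound v = begin
    degree G v
      ≤⟨ degree-generated Step v ⟩
    count (Step v) A + count (λ y → Step y v) A
      ≤⟨ +-mono-≤ (count-∨ (Up v) (λ y → Up (∁ v) (∁ y)) A) (count-∨ (λ y → Up y v) (λ y → Up (∁ y) (∁ v)) A) ⟩
    (count (Up v) A + count (λ y → Up (∁ v) (∁ y)) A) + (count (λ y → Up y v) A + count (λ y → Up (∁ y) (∁ v)) A)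
      ≡⟨ cong₂ (λ a b → (count (Up v) A + a) + (count (λ y → Up y v) A + b))
               (count-∁ (Up (∁ v))) (count-∁ (λ y → Up y (∁ v))) ⟩
    (count (Up v) A + count (Up (∁ v)) A) + (count (λ y → Up y v) A + count (λ y → Up y (∁ v)) A)
      ≡⟨ interchange (count (Up v) A) _ _ _ ⟩
    (count (Up v) A + count (λ y → Up y v) A) + (count (Up (∁ v)) A + count (λ y → Up y (∁ v)) A)
      ≤⟨ +-mono-≤ (up-load v) (up-load (∁ v)) ⟩
    suc K + suc K
      ≡⟨ cong (suc K +_) (sym (+-identityʳ (suc K))) ⟩
    2 * suc K ∎
    where open ≤-Reasoning
          A = allSubsets (suc M)

  up-edge : ∀ x → bit x (pivot x) ≡ false → x ⊂ up x × Edge G x (up x)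
  up-edge x off = x⊂up , generated-edge Step (⊂⇒≢ x⊂up) step
    where
    x⊂up = ⊂-setAt x (pivot x) (pivot<m x) off
    step : Step x (up x) ≡ true
    step rewrite off | ==ₛ-refl (up x) = refl

  down-edge : ∀ x → bit (∁ x) (pivot (∁ x)) ≡ false → down x ⊂ x × Edge G x (down x)
  down-edge x off = down⊂x , generated-edge Step (λ x≡ → ⊂⇒≢ down⊂x (sym x≡)) step
    where
    down⊂x : down x ⊂ x
    down⊂x = ∁p⊂∁q⇒p⊃q (subst (∁ x ⊂_) (sym (∁-involutive (up (∁ x)))) (⊂-setAt (∁ x) _ (pivot<m (∁ x)) off))
    step : Step x (down x) ≡ true
    step rewrite ∁-involutive (up (∁ x)) | off | ==ₛ-refl (up (∁ x)) = ∨-zeroʳ (Up x (down x))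

  -- The theorem's two neighbours exist as soon as (K+1)·|x| ≤ K·m, respectively
  -- (K+1)·(m − |x|) ≤ K·m, since then the walk of x, respectively of ∁ x, ends non-negative.
  up-neighbour : ∀ x → suc K * ∣ x ∣ ≤ K * suc M → Σ (Subset (suc M)) λ x₂ → x ⊂ x₂ × Edge G x x₂
  up-neighbour x light = up x , up-edge x (pivot-off x (walk-end-nonneg x light))

  down-neighbour : ∀ x → suc K * (suc M ∸ ∣ x ∣) ≤ K * suc M → Σ (Subset (suc M)) λ x₁ → x₁ ⊂ x × Edge G x x₁
  down-neighbour x co-light = down x , down-edge x (pivot-off (∁ x) (walk-end-nonneg (∁ x) light))
    where light : suc K * ∣ ∁ x ∣ ≤ K * suc M
          light = subst (λ s → suc K * s ≤ K * suc M) (sym (∣∁p∣≡n∸∣p∣ x)) co-light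

module Rationals where
  open import Data.Nat using (suc; _+_; _*_; _∸_; _≤_)
  open import Data.Nat.Properties
    using (*-identityˡ; *-identityʳ; *-assoc; +-comm; *-distribˡ-∸; m+n∸m≡n;
           *-monoˡ-≤; *-monoʳ-≤; +-monoʳ-≤; ∸-monoʳ-≤; *-cancelˡ-≤; +-cancelʳ-≤; module ≤-Reasoning)
  open import Data.Nat.Tactic.RingSolver using (solve-∀)
  open import Data.Integer as ℤ using (ℤ; +_; 1ℤ; -[1+_]; +[1+_])
  import Data.Integer.Properties as ℤₚ
  import Data.Integer.Tactic.RingSolver as ℤ-Solver
  open import Data.Integer.DivMod using ([n/d]*d≤n)
  open import Data.Rational as ℚ using (ℚ; mkℚ; ↥_; ↧_; 0ℚ; 1ℚ; _/_; *<*; toℚᵘ)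
  import Data.Rational.Properties as ℚₚ
  import Data.Rational.Unnormalised as ℚᵘ
  import Data.Rational.Unnormalised.Properties as ℚᵘₚ
  open import Data.Product using (_,_)
  open import Relation.Binary.PropositionalEquality

  -- A positive rational c = P/(Q+1) together with ⌈1/c⌉ = K + 1.  The one property of the
  -- ceiling that matters is (K + 1)·c ≥ 1, i.e. Q + 1 ≤ (K + 1)·P.
  record ReciprocalCeiling (c : ℚ) (0<c : 0ℚ ℚ.< c) : Set where
    field
      K P Q  : ℕ
      ceil≡  : ceilInv c 0<c ≡ + suc K
      num≡   : ↥ c ≡ + P
      den≡   : ↧ c ≡ + suc Q
      covers : suc Q ≤ suc K * P

  -- Computing ⌈1/c⌉ = −⌊−(Q+1)/P⌋ and using ⌊a/b⌋·b ≤ a.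
  reciprocalCeiling : ∀ c 0<c → ReciprocalCeiling c 0<c
  reciprocalCeiling (mkℚ (+ 0)      d _) (*<* (ℤ.+<+ ()))
  reciprocalCeiling (mkℚ -[1+ n ]   d _) (*<* ())
  reciprocalCeiling (mkℚ +[1+ n ] d _) 0<c with ceiling-positive (ℤ.- (-[1+ d ] ℤ./ + suc n)) ceiling-covers
    where
    ceiling-covers : + suc d ℤ.≤ ℤ.- (-[1+ d ] ℤ./ + suc n) ℤ.* + suc n
    ceiling-covers = subst (+ suc d ℤ.≤_) (ℤₚ.neg-distribˡ-* (-[1+ d ] ℤ./ + suc n) (+ suc n))
                   (ℤₚ.neg-mono-≤ ([n/d]*d≤n -[1+ d ] (+ suc n)))
    ceiling-positive : ∀ k → + suc d ℤ.≤ k ℤ.* + suc n → Σ ℕ λ K → k ≡ + suc K × suc d ≤ suc K * suc n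
    ceiling-positive +[1+ K ] (ℤ.+≤+ le) = K , refl , le
    ceiling-positive (+ 0)    (ℤ.+≤+ ())
  ... | K , ceil≡ , covers = record
    { K = K ; P = suc n ; Q = d ; ceil≡ = ceil≡ ; num≡ = refl ; den≡ = refl ; covers = covers }

  -- Inequalities between rationals are read off in ℚᵘ, where ≤ is cross-multiplication.
  toℚᵘ-nat : ∀ n → toℚᵘ (+ n / 1) ℚᵘ.≃ ℚᵘ.mkℚᵘ (+ n) 0
  toℚᵘ-nat n = ℚₚ.toℚᵘ-fromℚᵘ (ℚᵘ.mkℚᵘ (+ n) 0)

  lower-cross : ∀ c (x m : ℕ) → c ℚ.* (+ m / 1) ℚ.≤ + x / 1 → ↥ c ℤ.* + m ℤ.≤ + x ℤ.* ↧ c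
  lower-cross c@(mkℚ p d _) x m h =
    subst₂ ℤ._≤_ (ℤₚ.*-identityʳ (p ℤ.* + m)) (cong (λ z → + x ℤ.* + z) (*-identityʳ (suc d)))
           (ℚᵘₚ.drop-*≤* (ℚᵘₚ.≤-respʳ-≃ (toℚᵘ-nat x) (ℚᵘₚ.≤-respˡ-≃ product (ℚₚ.toℚᵘ-mono-≤ h))))
    where
    product : toℚᵘ (c ℚ.* (+ m / 1)) ℚᵘ.≃ ℚᵘ.mkℚᵘ p d ℚᵘ.* ℚᵘ.mkℚᵘ (+ m) 0
    product = ℚᵘₚ.≃-trans (ℚₚ.toℚᵘ-homo-* c (+ m / 1)) (ℚᵘₚ.*-congˡ {ℚᵘ.mkℚᵘ p d} (toℚᵘ-nat m))

  upper-cross : ∀ c (x m : ℕ) → + x / 1 ℚ.≤ (1ℚ ℚ.- c) ℚ.* (+ m / 1) →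
    + x ℤ.* ↧ c ℤ.+ ↥ c ℤ.* + m ℤ.≤ ↧ c ℤ.* + m
  upper-cross c@(mkℚ p d _) x m h = subst (+ x ℤ.* + suc d ℤ.+ p ℤ.* + m ℤ.≤_) (collect (+ suc d) p (+ m))
    (ℤₚ.+-monoˡ-≤ (p ℤ.* + m) (subst (λ z → + x ℤ.* + z ℤ.≤ scaled) (trans (*-identityʳ (1 * suc d)) (*-identityˡ (suc d))) cross))
    where
    difference : toℚᵘ ((1ℚ ℚ.- c) ℚ.* (+ m / 1)) ℚᵘ.≃ (ℚᵘ.mkℚᵘ (+ 1) 0 ℚᵘ.+ ℚᵘ.- ℚᵘ.mkℚᵘ p d) ℚᵘ.* ℚᵘ.mkℚᵘ (+ m) 0
    difference = ℚᵘₚ.≃-trans (ℚₚ.toℚᵘ-homo-* (1ℚ ℚ.- c) (+ m / 1))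
      (ℚᵘₚ.*-cong (ℚᵘₚ.≃-trans (ℚₚ.toℚᵘ-homo-+ 1ℚ (ℚ.- c)) (ℚᵘₚ.+-congʳ (ℚᵘ.mkℚᵘ (+ 1) 0) (ℚₚ.toℚᵘ-homo‿- c)))
                  (toℚᵘ-nat m))
    scaled = (((1ℤ ℤ.* + suc d) ℤ.+ (ℤ.- p) ℤ.* 1ℤ) ℤ.* + m) ℤ.* 1ℤ
    cross : + x ℤ.* + ((1 * suc d) * 1) ℤ.≤ scaled
    cross = ℚᵘₚ.drop-*≤* (ℚᵘₚ.≤-respʳ-≃ difference (ℚᵘₚ.≤-respˡ-≃ (toℚᵘ-nat x) (ℚₚ.toℚᵘ-mono-≤ h)))
    collect : ∀ q p m → (((1ℤ ℤ.* q) ℤ.+ (ℤ.- p) ℤ.* 1ℤ) ℤ.* m) ℤ.* 1ℤ ℤ.+ p ℤ.* m ≡ q ℤ.* m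
    collect = ℤ-Solver.solve-∀

  scale-lower : ∀ P Q k x m → P * m ≤ x * suc Q → suc Q ≤ k * P → m ≤ k * x
  scale-lower P Q k x m lower covers = *-cancelˡ-≤ (suc Q) (begin
    suc Q * m           ≤⟨ *-monoˡ-≤ m covers ⟩
    k * P * m           ≡⟨ *-assoc k P m ⟩
    k * (P * m)         ≤⟨ *-monoʳ-≤ k lower ⟩
    k * (x * suc Q)     ≡⟨ rearrange k x (suc Q) ⟩
    suc Q * (k * x)     ∎)
    where open ≤-Reasoning
          rearrange : ∀ k x q → k * (x * q) ≡ q * (k * x)
          rearrange = solve-∀

  scale-upper : ∀ P Q K x m → x * suc Q + P * m ≤ suc Q * m → suc Q ≤ suc K * P → suc K * x ≤ K * m
  scale-upper P Q K x m upper covers = +-cancelʳ-≤ m _ _ (subst (suc K * x + m ≤_) (+-comm m (K * m))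
    (*-cancelˡ-≤ (suc Q) (begin
      suc Q * (suc K * x + m)                       ≡⟨ expand Q K x m ⟩
      suc K * (x * suc Q) + suc Q * m               ≤⟨ +-monoʳ-≤ (suc K * (x * suc Q)) (*-monoˡ-≤ m covers) ⟩
      suc K * (x * suc Q) + suc K * P * m           ≡⟨ factor (suc K) x (suc Q) P m ⟩
      suc K * (x * suc Q + P * m)                   ≤⟨ *-monoʳ-≤ (suc K) upper ⟩
      suc K * (suc Q * m)                           ≡⟨ regroup K Q m ⟩
      suc Q * (m + K * m)                           ∎)))
    where
    open ≤-Reasoning
    expand : ∀ Q K x m → suc Q * (suc K * x + m) ≡ suc K * (x * suc Q) + suc Q * m
    expand = solve-∀
    factor : ∀ k x q P m → k * (x * q) + k * P * m ≡ k * (x * q + P * m)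
    factor = solve-∀
    regroup : ∀ K Q m → suc K * (suc Q * m) ≡ suc Q * (m + K * m)
    regroup = solve-∀

  scale-complement : ∀ K x m → m ≤ suc K * x → suc K * (m ∸ x) ≤ K * m
  scale-complement K x m m≤ = begin
    suc K * (m ∸ x)          ≡⟨ *-distribˡ-∸ (suc K) m x ⟩
    suc K * m ∸ suc K * x    ≤⟨ ∸-monoʳ-≤ (suc K * m) m≤ ⟩
    (m + K * m) ∸ m          ≡⟨ m+n∸m≡n m (K * m) ⟩
    K * m                    ∎
    where open ≤-Reasoning

  middle-layer : ∀ {c 0<c} (w : ReciprocalCeiling c 0<c) (x m : ℕ) →
    c ℚ.* (+ m / 1) ℚ.≤ + x / 1 → + x / 1 ℚ.≤ (1ℚ ℚ.- c) ℚ.* (+ m / 1) →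
    let open ReciprocalCeiling w in suc K * x ≤ K * m × suc K * (m ∸ x) ≤ K * m
  middle-layer {c} w x m above below =
    scale-upper P Q K x m upper covers , scale-complement K x m (scale-lower P Q (suc K) x m lower covers)
    where
    open ReciprocalCeiling w
    num*m : ↥ c ℤ.* + m ≡ + (P * m)
    num*m = trans (cong (λ z → z ℤ.* + m) num≡) (sym (ℤₚ.pos-* P m))
    x*den : + x ℤ.* ↧ c ≡ + (x * suc Q)
    x*den = trans (cong (λ z → + x ℤ.* z) den≡) (sym (ℤₚ.pos-* x (suc Q)))
    den*m : ↧ c ℤ.* + m ≡ + (suc Q * m)
    den*m = trans (cong (λ z → z ℤ.* + m) den≡) (sym (ℤₚ.pos-* (suc Q) m))
    lower : P * m ≤ x * suc Q
    lower = ℤₚ.drop‿+≤+ (subst₂ ℤ._≤_ num*m x*den (lower-cross c x m above))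
    upper : x * suc Q + P * m ≤ suc Q * m
    upper = ℤₚ.drop‿+≤+ (subst₂ ℤ._≤_ (trans (cong₂ ℤ._+_ x*den num*m) (sym (ℤₚ.pos-+ (x * suc Q) (P * m)))) den*m
                                     (upper-cross c x m below))

open import Data.Integer using (+_; _*_) renaming (_≤_ to _≤ℤ_)
open import Data.Rational using (ℚ; 0ℚ; 1ℚ; ½; _<_; _≤_; _/_; _-_) renaming (_*_ to _*ℚ_)
open import Data.Integer using (+≤+)

-- Take K + 1 = ⌈1/c⌉ and the construction on 2^[M+1], m = M + 1.
claim16 : (m : ℕ) → .{{_ : NonZero m}} → (c : ℚ) → (0<c : 0ℚ < c) → c < ½ →
  Σ (Graph m) λ G →
    ((v : Subset m) → + (degree G v) ≤ℤ (+ 2) * ceilInv c 0<c) ×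
    ((x : Subset m) → c *ℚ (+ m / 1) ≤ (+ ∣ x ∣ / 1) → (+ ∣ x ∣ / 1) ≤ (1ℚ - c) *ℚ (+ m / 1) →
      Σ (Subset m) λ x₁ → Σ (Subset m) λ x₂ →
        x₁ ⊂ x × x ⊂ x₂ × Edge G x x₁ × Edge G x x₂)
claim16 (suc M) c 0<c _ = G , degree-within , neighbours
  where
  ceiling = Rationals.reciprocalCeiling c 0<c
  open Rationals.ReciprocalCeiling ceiling using (K; ceil≡)
  open Construction K M

  degree-within : ∀ v → + (degree G v) ≤ℤ (+ 2) * ceilInv c 0<c
  degree-within v rewrite ceil≡ = +≤+ (degree-bound v)

  neighbours : ∀ x → c *ℚ (+ suc M / 1) ≤ (+ ∣ x ∣ / 1) → (+ ∣ x ∣ / 1) ≤ (1ℚ - c) *ℚ (+ suc M / 1) →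
    Σ (Subset (suc M)) λ x₁ → Σ (Subset (suc M)) λ x₂ → x₁ ⊂ x × x ⊂ x₂ × Edge G x x₁ × Edge G x x₂
  neighbours x above below with Rationals.middle-layer ceiling ∣ x ∣ (suc M) above below
  ... | light , co-light with down-neighbour x co-light | up-neighbour x light
  ...   | x₁ , x₁⊂x , edge₁ | x₂ , x⊂x₂ , edge₂ = x₁ , x₂ , x₁⊂x , x⊂x₂ , edge₁ , edge₂
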